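{- Let $\mathrm{SC}^{(\mathrm{def\,L''})}_{\mathrm{FO(ID)}}$ be the sequent calculus obtained from $\mathrm{SC}_{\mathrm{FO(ID)}}$ by replacing the rule (def L) with the rule (def L''). Then (def L) is admissible in $\mathrm{SC}^{(\mathrm{def\,L''})}_{\mathrm{FO(ID)}}$: whenever all premises of an instance of (def L) are provable in $\mathrm{SC}^{(\mathrm{def\,L''})}_{\mathrm{FO(ID)}}$, so is its conclusion.
   Context: FO-formulas: first-order logic with equality (atoms $P(\bar t)$, $t=s$, $\top,\bot$); object symbols are $0$-ary function symbols; $\varphi[t/x]$ is capture-avoiding substitution. Positive/negative occurrence: even/odd number of enclosing negations after rewriting $\Rightarrow,\Leftrightarrow$. A definitional rule is $\forall\bar x:P(\bar t)\leftarrow\varphi$ ($\varphi$ an FO-formula, its body); a definition $\Phi$ is a finite set of rules such that for each rule no object symbol of its $\bar x$ occurs freely in another rule; $\mathrm{Def}(\Phi)$ is the set of head predicates. FO(ID)-formulas are built from atoms and definitions by connectives and quantifiers; $\Gamma,\Delta$ denote finite sets of FO(ID)-formulas. The calculus $\mathrm{SC}_{\mathrm{FO(ID)}}$ (premises $\Rightarrow$ conclusion): (ax) no premises, $\Gamma\vdash\Delta$ if $\Gamma\cap\Delta\ne\emptyset$, $\bot\in\Gamma$ or $\top\in\Delta$; (wk) $\Gamma'\vdash\Delta'\Rightarrow\Gamma\vdash\Delta$ for $\Gamma'\subseteq\Gamma,\Delta'\subseteq\Delta$; (subst) $\Gamma\vdash\Delta\Rightarrow\Gamma[t/x]\vdash\Delta[t/x]$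 if no object symbol quantified in $\Gamma\cup\Delta$ occurs in $t$; (cut) $\Gamma\vdash\varphi,\Delta$, $\Gamma,\varphi\vdash\Delta\Rightarrow\Gamma\vdash\Delta$; the standard classical Gentzen left/right rules for $\neg,\wedge,\vee,\Rightarrow,\Leftrightarrow,\forall,\exists$ (eigenvariable conditions on $\forall$R, $\exists$L); ($=$L) $\Gamma[s/x,t/y]\vdash\Delta[s/x,t/y]\Rightarrow\Gamma[t/x,s/y],t=s\vdash\Delta[t/x,s/y]$; ($=$R) no premises, $\Gamma\vdash t=t,\Delta$; (def R) $\Gamma,\Phi\vdash\varphi[\bar s/\bar x],\Delta\Rightarrow\Gamma,\Phi\vdash P(\bar t[\bar s/\bar x]),\Delta$ for a rule $\forall\bar x:P(\bar t)\leftarrow\varphi$ of $\Phi$ and a tuple $\bar s$ of object symbols; (def L) for a definition $\Phi$, $P\in\Pi\subseteq\mathrm{Def}(\Phi)$, and for each $Q\in\Pi$ an FO-formula $F_Q$ with chosen distinct object symbols $\bar z_Q$ ($F_Q[\bar u]:=F_Q[\bar u/\bar z_Q]$): from minor premises $\Gamma,\Phi,\psi[F_\Pi/\Pi^+]\vdash F_Q[\bar s],\Delta$ for each rule $\forall\bar y:Q(\bar s)\leftarrow\psi$ of $\Phi$ with $Q\in\Pi$ and the major premise $\Gamma,\Phi,F_P[\bar v]\vdash\Delta$ infer $\Gamma,\Phi,P(\bar v)\vdash\Delta$; side condition: for each rule $\forall\bar y:Q(\bar s)\leftarrow\psi$ of $\Phi$ the $\bar y$ are not free in $\Gamma,\Delta,\Phi$;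 $\psi[F_\Pi/\Pi^+]$ replaces each positive occurrence of $R(\bar u)$, $R\in\Pi$, by $F_R[\bar u]$. The rule (def L'') has the same data, side condition and minor premises as (def L), no major premise, and conclusion $\Gamma,\Phi,P(\bar v)\vdash F_P[\bar v],\Delta$. A proof is a finite tree of sequents whose nodes are conclusions of rule instances with premises at the children. -}

module Defs where

open import Data.Nat using (ℕ; zero; suc; _+_; _⊔_; _≡ᵇ_)
open import Data.Bool using (Bool; true; false; if_then_else_; _∨_; _∧_; not)
open import Data.List using (List; []; _∷_; _++_; map; length; zip; concatMap)
open import Data.List.Membership.Propositional using (_∈_; _∉_)
open import Data.List.Relation.Unary.Unique.Propositional using (Unique)
open import Data.Product using (_×_; _,_; proj₁; proj₂)
open import Data.Maybe using (Maybe; just; nothing)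
open import Data.Empty using (⊥)
open import Relation.Binary.PropositionalEquality using (_≡_)

-- Function symbols are pairs (name, arity); a term
-- `fn f ts` uses the symbol (f , length ts).  Object symbols are the
-- 0-ary function symbols, identified with their name x : ℕ
-- (the term `obj x = fn x []`).  Predicate symbols are pairs
-- (name , arity) (PSym); the atom `atom p ts` uses (p , length ts).

data Term : Set where
  fn : ℕ → List Term → Term

obj : ℕ → Term
obj x = fn x []

PSym : Set
PSym = ℕ × ℕ

-- simultaneous substitution of terms for object symbols (first match wins)
Subst : Set
Subst = List (ℕ × Term)

memb : ℕ → List ℕ → Bool
memb x [] = false
memb x (y ∷ ys) = (x ≡ᵇ y) ∨ memb x ys

membP : PSym → List PSym → Bool
membP P [] = false
membP P (Q ∷ Qs) = ((proj₁ P ≡ᵇ proj₁ Q) ∧ (proj₂ P ≡ᵇ proj₂ Q)) ∨ membP P Qs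

minus : List ℕ → List ℕ → List ℕ
minus [] ys = []
minus (x ∷ xs) ys = if memb x ys then minus xs ys else x ∷ minus xs ys

maxL : List ℕ → ℕ
maxL [] = 0
maxL (x ∷ xs) = x ⊔ maxL xs

lookupS : Subst → ℕ → Maybe Term
lookupS [] x = nothing
lookupS ((y , t) ∷ σ) x = if x ≡ᵇ y then just t else lookupS σ x

mutual
  subT : Subst → Term → Term
  subT σ (fn x []) with lookupS σ x
  ... | just t = t
  ... | nothing = fn x []
  subT σ (fn f (a ∷ as)) = fn f (subTs σ (a ∷ as))

  subTs : Subst → List Term → List Term
  subTs σ [] = []
  subTs σ (a ∷ as) = subT σ a ∷ subTs σ as

mutual
  objsT : Term → List ℕ
  objsT (fn x []) = x ∷ []
  objsT (fn f (a ∷ as)) = objsTs (a ∷ as)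

  objsTs : List Term → List ℕ
  objsTs [] = []
  objsTs (a ∷ as) = objsT a ++ objsTs as

-- largest name of any symbol occurring in a term (used for freshness)
mutual
  maxT : Term → ℕ
  maxT (fn f as) = f ⊔ maxTs as

  maxTs : List Term → ℕ
  maxTs [] = 0
  maxTs (a ∷ as) = maxT a ⊔ maxTs as

maxSub : Subst → ℕ
maxSub [] = 0
maxSub ((x , t) ∷ σ) = x ⊔ maxT t ⊔ maxSub σ

occRange : ℕ → Subst → Bool
occRange y [] = false
occRange y ((x , t) ∷ σ) = memb y (objsT t) ∨ occRange y σ

relevant : List ℕ → List ℕ → Subst → Subst
relevant bs fvs [] = []
relevant bs fvs ((x , t) ∷ σ) =
  if not (memb x bs) ∧ memb x fvs then (x , t) ∷ relevant bs fvs σ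
  else relevant bs fvs σ

-- rename the captured binders among `vs` to fresh names above m
renameBinders : ℕ → (ℕ → Bool) → ℕ → List ℕ → List ℕ × Subst
renameBinders m cap i [] = [] , []
renameBinders m cap i (v ∷ vs) with renameBinders m cap (suc i) vs
... | ws , ρ = if cap v then (suc (m + i) ∷ ws , (v , obj (suc (m + i))) ∷ ρ)
               else (v ∷ ws , ρ)

-- Formulas, parametrised by the type D of "definition" atoms.
-- FO = Fm ⊥ (FO-formulas), FOID = Fm Definition (FO(ID)-formulas).

data Fm (D : Set) : Set where
  atom : ℕ → List Term → Fm D
  _≐_  : Term → Term → Fm D
  ⊤f ⊥f : Fm D
  ¬f   : Fm D → Fm D
  _∧f_ _∨f_ _⇒f_ _⇔f_ : Fm D → Fm D → Fm D
  ∀f ∃f : ℕ → Fm D → Fm D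
  def  : D → Fm D

record DSyn (D : Set) : Set where
  field
    maxD   : D → ℕ
    freeD  : D → List ℕ
    boundD : D → List ℕ
    subD   : Subst → D → D

module FmOps {D : Set} (S : DSyn D) where
  open DSyn S

  maxFm : Fm D → ℕ
  maxFm (atom p ts) = p ⊔ maxTs ts
  maxFm (t ≐ s) = maxT t ⊔ maxT s
  maxFm ⊤f = 0
  maxFm ⊥f = 0
  maxFm (¬f φ) = maxFm φ
  maxFm (φ ∧f ψ) = maxFm φ ⊔ maxFm ψ
  maxFm (φ ∨f ψ) = maxFm φ ⊔ maxFm ψ
  maxFm (φ ⇒f ψ) = maxFm φ ⊔ maxFm ψ
  maxFm (φ ⇔f ψ) = maxFm φ ⊔ maxFm ψ
  maxFm (∀f x φ) = x ⊔ maxFm φ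
  maxFm (∃f x φ) = x ⊔ maxFm φ
  maxFm (def d) = maxD d

  fv : Fm D → List ℕ
  fv (atom p ts) = objsTs ts
  fv (t ≐ s) = objsT t ++ objsT s
  fv ⊤f = []
  fv ⊥f = []
  fv (¬f φ) = fv φ
  fv (φ ∧f ψ) = fv φ ++ fv ψ
  fv (φ ∨f ψ) = fv φ ++ fv ψ
  fv (φ ⇒f ψ) = fv φ ++ fv ψ
  fv (φ ⇔f ψ) = fv φ ++ fv ψ
  fv (∀f x φ) = minus (fv φ) (x ∷ [])
  fv (∃f x φ) = minus (fv φ) (x ∷ [])
  fv (def d) = freeD d

  bv : Fm D → List ℕ
  bv (atom p ts) = []
  bv (t ≐ s) = []
  bv ⊤f = []
  bv ⊥f = []
  bv (¬f φ) = bv φ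
  bv (φ ∧f ψ) = bv φ ++ bv ψ
  bv (φ ∨f ψ) = bv φ ++ bv ψ
  bv (φ ⇒f ψ) = bv φ ++ bv ψ
  bv (φ ⇔f ψ) = bv φ ++ bv ψ
  bv (∀f x φ) = x ∷ bv φ
  bv (∃f x φ) = x ∷ bv φ
  bv (def d) = boundD d

  sub : Subst → Fm D → Fm D
  subBind : (ℕ → Fm D → Fm D) → Subst → ℕ → Fm D → Fm D
  sub σ (atom p ts) = atom p (subTs σ ts)
  sub σ (t ≐ s) = subT σ t ≐ subT σ s
  sub σ ⊤f = ⊤f
  sub σ ⊥f = ⊥f
  sub σ (¬f φ) = ¬f (sub σ φ)
  sub σ (φ ∧f ψ) = sub σ φ ∧f sub σ ψ
  sub σ (φ ∨f ψ) = sub σ φ ∨f sub σ ψ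
  sub σ (φ ⇒f ψ) = sub σ φ ⇒f sub σ ψ
  sub σ (φ ⇔f ψ) = sub σ φ ⇔f sub σ ψ
  sub σ (∀f x φ) = subBind ∀f σ x φ
  sub σ (∃f x φ) = subBind ∃f σ x φ
  sub σ (def d) = def (subD σ d)
  subBind Q σ x φ =
    let σ' = relevant (x ∷ []) (fv φ) σ
        m  = suc (x ⊔ maxFm φ ⊔ maxSub σ)
    in if occRange x σ'
       then Q m (sub ((x , obj m) ∷ σ') φ)
       else Q x (sub σ' φ)

FO : Set
FO = Fm ⊥

noD : DSyn ⊥
noD = record { maxD = λ () ; freeD = λ () ; boundD = λ () ; subD = λ _ () }

module FOo = FmOps noD

-- Definitional rules  ∀ vars : P(hargs) ← body   and definitions

record Rule : Set where
  constructor mkRule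
  field
    vars  : List ℕ
    hname : ℕ
    hargs : List Term
    body  : FO

open Rule public

headSym : Rule → PSym
headSym r = hname r , length (hargs r)

-- a definition: a finite set of rules (represented by a list)
Definition : Set
Definition = List Rule

Def : Definition → List PSym
Def Φ = map headSym Φ

freeRule : Rule → List ℕ
freeRule r = minus (objsTs (hargs r) ++ FOo.fv (body r)) (vars r)

boundRule : Rule → List ℕ
boundRule r = vars r ++ FOo.bv (body r)

maxRule : Rule → ℕ
maxRule r = maxL (vars r) ⊔ hname r ⊔ maxTs (hargs r) ⊔ FOo.maxFm (body r)

subRule : Subst → Rule → Rule
subRule σ r with renameBinders (suc (maxRule r ⊔ maxSub σ))
                   (λ v → occRange v (relevant (vars r) (freeRule r) σ)) 0 (vars r)
... | ws , ρ = mkRule ws (hname r) (subTs σ' (hargs r)) (FOo.sub σ' (body r))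
  where σ' = ρ ++ relevant (vars r) (freeRule r) σ

defSyn : DSyn Definition
defSyn = record
  { maxD = λ Φ → maxL (map maxRule Φ)
  ; freeD = concatMap freeRule
  ; boundD = concatMap boundRule
  ; subD = λ σ → map (subRule σ)
  }

WFDef : Definition → Set
WFDef Φ = ∀ pre r post → Φ ≡ pre ++ (r ∷ post) →
          ∀ x → x ∈ vars r → ∀ r' → r' ∈ pre ++ post → x ∉ freeRule r'

FOID : Set
FOID = Fm Definition

module ID = FmOps defSyn

emb : FO → FOID
emb (atom p ts) = atom p ts
emb (t ≐ s) = t ≐ s
emb ⊤f = ⊤f
emb ⊥f = ⊥f
emb (¬f φ) = ¬f (emb φ)
emb (φ ∧f ψ) = emb φ ∧f emb ψ
emb (φ ∨f ψ) = emb φ ∨f emb ψ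
emb (φ ⇒f ψ) = emb φ ⇒f emb ψ
emb (φ ⇔f ψ) = emb φ ⇔f emb ψ
emb (∀f x φ) = ∀f x (emb φ)
emb (∃f x φ) = ∃f x (emb φ)
emb (def ())

Seq : Set
Seq = List FOID

subS : Subst → Seq → Seq
subS σ = map (ID.sub σ)

fvS : Seq → List ℕ
fvS = concatMap ID.fv

bvS : Seq → List ℕ
bvS = concatMap ID.bv

-- Data of an instance of (def L) / (def L''):  Π, F_Q, z̄_Q

record DefLData (Φ : Definition) (P : PSym) : Set where
  field
    Π     : List PSym
    F     : PSym → FO
    z     : PSym → List ℕ
    P∈Π   : P ∈ Π
    Π⊆Def : ∀ {Q} → Q ∈ Π → Q ∈ Def Φ
    z-len : ∀ {Q} → Q ∈ Π → length (z Q) ≡ proj₂ Q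
    z-uniq : ∀ {Q} → Q ∈ Π → Unique (z Q)

  inst : PSym → List Term → FO
  inst Q us = FOo.sub (zip (z Q) us) (F Q)

  avoidF : List ℕ
  avoidF = concatMap (λ Q → minus (FOo.fv (F Q)) (z Q)) Π

  maxF : ℕ
  maxF = maxL (map (λ Q → FOo.maxFm (F Q) ⊔ maxL (z Q)) Π)

  -- ψ[F_Π/Π⁺]: replace each positive occurrence of R(ū), R ∈ Π, by
  -- F_R[ū] (capture-avoiding: bound symbols of ψ clashing with free
  -- symbols of the F_R are renamed).  The Boolean is the polarity; σ
  -- records renamings of bound symbols.
  mentionsΠ : FO → Bool
  mentionsΠ (atom p ts) = membP (p , length ts) Π
  mentionsΠ (t ≐ s) = false
  mentionsΠ ⊤f = false
  mentionsΠ ⊥f = false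
  mentionsΠ (¬f φ) = mentionsΠ φ
  mentionsΠ (φ ∧f ψ) = mentionsΠ φ ∨ mentionsΠ ψ
  mentionsΠ (φ ∨f ψ) = mentionsΠ φ ∨ mentionsΠ ψ
  mentionsΠ (φ ⇒f ψ) = mentionsΠ φ ∨ mentionsΠ ψ
  mentionsΠ (φ ⇔f ψ) = mentionsΠ φ ∨ mentionsΠ ψ
  mentionsΠ (∀f x φ) = mentionsΠ φ
  mentionsΠ (∃f x φ) = mentionsΠ φ
  mentionsΠ (def ())

  repl : Bool → Subst → FO → FO
  replBind : (ℕ → FO → FO) → Bool → Subst → ℕ → FO → FO
  repl p σ (atom R us) =
    if p ∧ membP (R , length us) Π
    then inst (R , length us) (subTs σ us)
    else atom R (subTs σ us)
  repl p σ (t ≐ s) = subT σ t ≐ subT σ s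
  repl p σ ⊤f = ⊤f
  repl p σ ⊥f = ⊥f
  repl p σ (¬f φ) = ¬f (repl (not p) σ φ)
  repl p σ (φ ∧f ψ) = repl p σ φ ∧f repl p σ ψ
  repl p σ (φ ∨f ψ) = repl p σ φ ∨f repl p σ ψ
  repl p σ (φ ⇒f ψ) = repl (not p) σ φ ⇒f repl p σ ψ
  -- φ ⇔ ψ is read as (φ ⇒ ψ) ∧ (ψ ⇒ φ) when replacement can occur in it
  repl p σ (φ ⇔f ψ) =
    if mentionsΠ φ ∨ mentionsΠ ψ
    then (repl (not p) σ φ ⇒f repl p σ ψ) ∧f (repl (not p) σ ψ ⇒f repl p σ φ)
    else FOo.sub σ φ ⇔f FOo.sub σ ψ
  repl p σ (∀f x φ) = replBind ∀f p σ x φ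
  repl p σ (∃f x φ) = replBind ∃f p σ x φ
  repl p σ (def ())
  replBind Q p σ x φ =
    let σ' = relevant (x ∷ []) (FOo.fv φ) σ
        m  = suc (x ⊔ FOo.maxFm φ ⊔ maxSub σ ⊔ maxF)
    in if occRange x σ' ∨ memb x avoidF
       then Q m (repl p ((x , obj m) ∷ σ') φ)
       else Q x (repl p σ' φ)

  _[F/Π⁺] : FO → FO
  ψ [F/Π⁺] = repl true [] ψ

DefLSide : Seq → Seq → Definition → Set
DefLSide Γ Δ Φ = ∀ r → r ∈ Φ → ∀ y → y ∈ vars r → y ∉ fvS (def Φ ∷ Γ ++ Δ)

minorL : ∀ {Φ P} → DefLData Φ P → Seq → Seq → Rule → Seq × Seq
minorL {Φ} D Γ Δ r =
  (emb (body r [F/Π⁺]) ∷ def Φ ∷ Γ) , (emb (inst (headSym r) (hargs r)) ∷ Δ)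
  where open DefLData D

-- The sequent calculi.  `withDefL` = SC_FO(ID); `withDefL''` = the
-- variant in which (def L) is replaced by (def L'').

data Variant : Set where
  withDefL withDefL'' : Variant

infix 3 _⊢[_]_

data _⊢[_]_ : Seq → Variant → Seq → Set where
  ax   : ∀ {V Γ Δ φ} → φ ∈ Γ → φ ∈ Δ → Γ ⊢[ V ] Δ
  ax⊥  : ∀ {V Γ Δ} → ⊥f ∈ Γ → Γ ⊢[ V ] Δ
  ax⊤  : ∀ {V Γ Δ} → ⊤f ∈ Δ → Γ ⊢[ V ] Δ
  wk   : ∀ {V Γ Δ Γ' Δ'} → (∀ {φ} → φ ∈ Γ' → φ ∈ Γ) → (∀ {φ} → φ ∈ Δ' → φ ∈ Δ) →
         Γ' ⊢[ V ] Δ' → Γ ⊢[ V ] Δ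
  subst : ∀ {V Γ Δ} x t → (∀ y → y ∈ bvS (Γ ++ Δ) → y ∉ objsT t) →
         Γ ⊢[ V ] Δ → subS ((x , t) ∷ []) Γ ⊢[ V ] subS ((x , t) ∷ []) Δ
  cut  : ∀ {V Γ Δ} φ → Γ ⊢[ V ] φ ∷ Δ → φ ∷ Γ ⊢[ V ] Δ → Γ ⊢[ V ] Δ
  ¬L   : ∀ {V Γ Δ φ} → Γ ⊢[ V ] φ ∷ Δ → ¬f φ ∷ Γ ⊢[ V ] Δ
  ¬R   : ∀ {V Γ Δ φ} → φ ∷ Γ ⊢[ V ] Δ → Γ ⊢[ V ] ¬f φ ∷ Δ
  ∧L   : ∀ {V Γ Δ φ ψ} → φ ∷ ψ ∷ Γ ⊢[ V ] Δ → (φ ∧f ψ) ∷ Γ ⊢[ V ] Δ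
  ∧R   : ∀ {V Γ Δ φ ψ} → Γ ⊢[ V ] φ ∷ Δ → Γ ⊢[ V ] ψ ∷ Δ → Γ ⊢[ V ] (φ ∧f ψ) ∷ Δ
  ∨L   : ∀ {V Γ Δ φ ψ} → φ ∷ Γ ⊢[ V ] Δ → ψ ∷ Γ ⊢[ V ] Δ → (φ ∨f ψ) ∷ Γ ⊢[ V ] Δ
  ∨R   : ∀ {V Γ Δ φ ψ} → Γ ⊢[ V ] φ ∷ ψ ∷ Δ → Γ ⊢[ V ] (φ ∨f ψ) ∷ Δ
  ⇒L   : ∀ {V Γ Δ φ ψ} → Γ ⊢[ V ] φ ∷ Δ → ψ ∷ Γ ⊢[ V ] Δ → (φ ⇒f ψ) ∷ Γ ⊢[ V ] Δ
  ⇒R   : ∀ {V Γ Δ φ ψ} → φ ∷ Γ ⊢[ V ] ψ ∷ Δ → Γ ⊢[ V ] (φ ⇒f ψ) ∷ Δ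
  ⇔L   : ∀ {V Γ Δ φ ψ} → φ ∷ ψ ∷ Γ ⊢[ V ] Δ → Γ ⊢[ V ] φ ∷ ψ ∷ Δ →
         (φ ⇔f ψ) ∷ Γ ⊢[ V ] Δ
  ⇔R   : ∀ {V Γ Δ φ ψ} → φ ∷ Γ ⊢[ V ] ψ ∷ Δ → ψ ∷ Γ ⊢[ V ] φ ∷ Δ →
         Γ ⊢[ V ] (φ ⇔f ψ) ∷ Δ
  ∀L   : ∀ {V Γ Δ x φ} t → ID.sub ((x , t) ∷ []) φ ∷ Γ ⊢[ V ] Δ → ∀f x φ ∷ Γ ⊢[ V ] Δ
  ∀R   : ∀ {V Γ Δ x φ} y → y ∉ fvS (∀f x φ ∷ Γ ++ Δ) →
         Γ ⊢[ V ] ID.sub ((x , obj y) ∷ []) φ ∷ Δ → Γ ⊢[ V ] ∀f x φ ∷ Δ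
  ∃L   : ∀ {V Γ Δ x φ} y → y ∉ fvS (∃f x φ ∷ Γ ++ Δ) →
         ID.sub ((x , obj y) ∷ []) φ ∷ Γ ⊢[ V ] Δ → ∃f x φ ∷ Γ ⊢[ V ] Δ
  ∃R   : ∀ {V Γ Δ x φ} t → Γ ⊢[ V ] ID.sub ((x , t) ∷ []) φ ∷ Δ → Γ ⊢[ V ] ∃f x φ ∷ Δ
  =L   : ∀ {V Γ Δ} x y s t →
         subS ((x , s) ∷ (y , t) ∷ []) Γ ⊢[ V ] subS ((x , s) ∷ (y , t) ∷ []) Δ →
         (t ≐ s) ∷ subS ((x , t) ∷ (y , s) ∷ []) Γ ⊢[ V ] subS ((x , t) ∷ (y , s) ∷ []) Δ
  =R   : ∀ {V Γ Δ t} → Γ ⊢[ V ] (t ≐ t) ∷ Δ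
  defR : ∀ {V Γ Δ Φ} → WFDef Φ → ∀ r → r ∈ Φ → (ss : List ℕ) → length ss ≡ length (vars r) →
         def Φ ∷ Γ ⊢[ V ] emb (FOo.sub (zip (vars r) (map obj ss)) (body r)) ∷ Δ →
         def Φ ∷ Γ ⊢[ V ] atom (hname r) (subTs (zip (vars r) (map obj ss)) (hargs r)) ∷ Δ
  defL : ∀ {Γ Δ Φ p vs} → WFDef Φ → (D : DefLData Φ (p , length vs)) → DefLSide Γ Δ Φ →
         (∀ r → r ∈ Φ → headSym r ∈ DefLData.Π D →
            proj₁ (minorL D Γ Δ r) ⊢[ withDefL ] proj₂ (minorL D Γ Δ r)) →
         emb (DefLData.inst D (p , length vs) vs) ∷ def Φ ∷ Γ ⊢[ withDefL ] Δ →
         atom p vs ∷ def Φ ∷ Γ ⊢[ withDefL ] Δ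
  defL'' : ∀ {Γ Δ Φ p vs} → WFDef Φ → (D : DefLData Φ (p , length vs)) → DefLSide Γ Δ Φ →
         (∀ r → r ∈ Φ → headSym r ∈ DefLData.Π D →
            proj₁ (minorL D Γ Δ r) ⊢[ withDefL'' ] proj₂ (minorL D Γ Δ r)) →
         atom p vs ∷ def Φ ∷ Γ ⊢[ withDefL'' ]
           emb (DefLData.inst D (p , length vs) vs) ∷ Δ

{-# OPTIONS --safe #-}
module Submission where

open import Defs
open import Data.List using (List; _∷_; length)
open import Data.List.Membership.Propositional using (_∈_)
open import Data.List.Relation.Binary.Subset.Propositional.Properties using (⊆-refl; xs⊆x∷xs; ∷⁺ʳ)
open import Data.Product using (_,_; proj₁; proj₂)

weaken-second : ∀ {V φ ψ Γ Δ} → φ ∷ Γ ⊢[ V ] Δ → φ ∷ ψ ∷ Γ ⊢[ V ] Δ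
weaken-second {φ = φ} {ψ} {Γ} = wk (∷⁺ʳ φ (xs⊆x∷xs Γ ψ)) ⊆-refl

proposition3p7 : ∀ {Γ Δ : Seq} {Φ : Definition} {p} {vs : List Term} →
    WFDef Φ → (D : DefLData Φ (p , length vs)) → DefLSide Γ Δ Φ →
    (∀ r → r ∈ Φ → headSym r ∈ DefLData.Π D →
      proj₁ (minorL D Γ Δ r) ⊢[ withDefL'' ] proj₂ (minorL D Γ Δ r)) →
    emb (DefLData.inst D (p , length vs) vs) ∷ def Φ ∷ Γ ⊢[ withDefL'' ] Δ →
    atom p vs ∷ def Φ ∷ Γ ⊢[ withDefL'' ] Δ
proposition3p7 wf D side minors major =
  cut _ (defL'' wf D side minors) (weaken-second major)
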